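{- Let $T$ be a tree and let $\ell\ge 1$ be an integer. Then $\chi_s'(T\Box C_{2\ell+1})\ge \left\lceil \frac{(2\ell+1)(\Delta(T)+1)}{\ell}\right\rceil$, where $C_{2\ell+1}$ is the cycle of length $2\ell+1$.
   Context: $\Delta(T)$ is the maximum degree of $T$. The Cartesian product $G\Box H$ has vertex set $V(G)\times V(H)$, with $(a,u)\sim(b,v)$ iff either $a=b$ and $uv\in E(H)$, or $u=v$ and $ab\in E(G)$. A strong edge coloring is a proper edge coloring in which every color class is an induced matching; $\chi_s'(G)$ is the minimum number of colors in such a coloring. -}

module Defs where

open import Data.Nat using (ℕ; zero; suc; _+_; _*_; _∸_; _≤_; _⊔_; NonZero)
open import Data.Nat.DivMod using (_/_)
open import Data.Fin using (Fin; toℕ)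
open import Data.Bool using (Bool; true; false; T)
open import Data.List using (List; []; _∷_; length; allFin; map; foldr; last)
open import Data.Nat.ListAction using (sum)
open import Data.List.Relation.Unary.Unique.Propositional using (Unique)
open import Data.Maybe using (Maybe; just; nothing)
open import Data.Product using (_×_; Σ; _,_)
open import Data.Sum using (_⊎_)
open import Data.Empty using (⊥)
open import Relation.Nullary using (¬_)
open import Relation.Binary.PropositionalEquality using (_≡_)

-- Graphs on an arbitrary vertex type, given by an adjacency relation
-- (all graphs used below are simple: symmetric and irreflexive)

record Graph : Set₁ where
  field
    V   : Set
    Adj : V → V → Set
open Graph public

record FinGraph : Set where
  field
    n   : ℕ
    adj : Fin n → Fin n → Bool
    adj-sym    : ∀ u v → adj u v ≡ adj v u
    adj-irrefl : ∀ u → adj u u ≡ false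
open FinGraph public

toGraph : FinGraph → Graph
toGraph G = record
  { V = Fin (n G)
  ; Adj = λ u v → T (adj G u v)
  }

b2n : Bool → ℕ
b2n true  = 1
b2n false = 0

degree : (G : FinGraph) → Fin (n G) → ℕ
degree G v = sum (map (λ u → b2n (adj G v u)) (allFin (n G)))

Δ : FinGraph → ℕ
Δ G = foldr _⊔_ 0 (map (degree G) (allFin (n G)))

data Reach (G : FinGraph) : Fin (n G) → Fin (n G) → Set where
  here : ∀ {u} → Reach G u u
  step : ∀ {u v w} → T (adj G u v) → Reach G v w → Reach G u w

Connected : FinGraph → Set
Connected G = ∀ u v → Reach G u v

data Chain (G : FinGraph) : List (Fin (n G)) → Set where
  nil  : Chain G []
  one  : ∀ {u} → Chain G (u ∷ [])
  cons : ∀ {u v vs} → T (adj G u v) → Chain G (v ∷ vs) → Chain G (u ∷ v ∷ vs)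

IsCycle : (G : FinGraph) → List (Fin (n G)) → Set
IsCycle G [] = ⊥
IsCycle G (v₀ ∷ vs) =
  3 ≤ length (v₀ ∷ vs) × Unique (v₀ ∷ vs) × Chain G (v₀ ∷ vs) ×
  Σ (Fin (n G)) (λ vk → last (v₀ ∷ vs) ≡ just vk × T (adj G vk v₀))

Acyclic : FinGraph → Set
Acyclic G = ∀ cs → ¬ IsCycle G cs

IsTree : FinGraph → Set
IsTree G = 1 ≤ n G × Connected G × Acyclic G

CycleAdj : (m : ℕ) → Fin m → Fin m → Set
CycleAdj m i j = (suc (toℕ i) ≡ toℕ j) ⊎ (suc (toℕ j) ≡ toℕ i)
               ⊎ ((suc (toℕ i) ≡ m) × (toℕ j ≡ 0))
               ⊎ ((suc (toℕ j) ≡ m) × (toℕ i ≡ 0))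

-- the cycle graph C_m (a genuine simple cycle when m ≥ 3)
cycleGraph : ℕ → Graph
cycleGraph m = record { V = Fin m ; Adj = CycleAdj m }

_□_ : Graph → Graph → Graph
G □ H = record
  { V = V G × V H
  ; Adj = λ { (a , u) (b , v) → (a ≡ b × Adj H u v) ⊎ (u ≡ v × Adj G a b) }
  }

record EdgeColouring (G : Graph) (k : ℕ) : Set where
  field
    col     : ∀ u v → Adj G u v → Fin k
    col-sym : ∀ u v (e : Adj G u v) (e' : Adj G v u) → col u v e ≡ col v u e'
open EdgeColouring public

-- every colour class is an induced matching: if edges uv and xy get the same
-- colour and u = x or u ~ x, then uv and xy are the same edge
IsStrong : (G : Graph) {k : ℕ} → EdgeColouring G k → Set
IsStrong G c = ∀ u v x y (e : Adj G u v) (f : Adj G x y) →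
  col c u v e ≡ col c x y f →
  (u ≡ x ⊎ Adj G u x) →
  (u ≡ x × v ≡ y) ⊎ (u ≡ y × v ≡ x)

χs'≥ : Graph → ℕ → Set
χs'≥ G m = ∀ k (c : EdgeColouring G k) → IsStrong G c → m ≤ k

-- ceiling division ⌈ a / b ⌉ for b ≥ 1 (value 0 for b = 0, never used)
⌈_/_⌉ : ℕ → ℕ → ℕ
⌈ a / zero ⌉  = 0
⌈ a / suc b ⌉ = (a + b) / suc b

-- Let v be a vertex of maximum degree Δ. For each vertex i of the cycle C, the Δ edges of the copy
-- T × {i} at (v, i) together with the cycle edge from (v, i) to (v, i + 1) are Δ + 1 pairwise adjacent
-- edges, so they receive distinct colours. For adjacent i and j the two stars share no colour: their
-- centres (v, i) and (v, j) are adjacent, so a shared colour would have to be a single edge lying in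
-- both stars, which is impossible as C has length at least 3. Hence every colour class meets the stars
-- of an independent set of layers of C₂ₗ₊₁, i.e. at most ℓ of them, and double counting gives
-- (2ℓ + 1)(Δ + 1) ≤ kℓ. Nothing about T beyond its having a vertex is used.

module Submission where

open import Defs
open import Data.Nat using (ℕ; zero; suc; _+_; _*_; _≤_; z≤n; s≤s; s≤s⁻¹)
import Data.Nat as ℕ
open import Data.Nat.Properties hiding (_≟_)
open import Data.Nat.DivMod using (m<n*o⇒m/o<n)
import Data.Nat.ListAction as List
open import Data.Bool using (Bool; true; false; T)
open import Data.Unit using (tt)
open import Data.Fin using (Fin; zero; suc; toℕ; fromℕ; fromℕ<; inject₁; lower₁)
open import Data.Fin.Properties using (_≟_; any?; toℕ-fromℕ; toℕ-inject₁; toℕ-lower₁)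
import Data.Fin.Properties as Fin
open import Data.List using (map; allFin; tabulate)
open import Data.List.Properties using (map-tabulate)
open import Data.List.Membership.Propositional.Properties using (foldr-selective; ∈-map⁻)
open import Data.Product using (∃; _,_; _×_; proj₁; proj₂)
open import Data.Product.Properties using (,-injectiveˡ; ,-injectiveʳ)
open import Data.Sum using (_⊎_; inj₁; inj₂; [_,_])
open import Data.Empty using (⊥; ⊥-elim)
open import Function using (_∘_; id)
open import Function.Definitions using (Injective)
open import Relation.Nullary using (¬_; yes; no; does; contradiction)
open import Relation.Binary.PropositionalEquality
  using (_≡_; _≢_; refl; sym; trans; cong; cong₂; subst; module ≡-Reasoning)

open import Algebra.Properties.CommutativeMonoid.Sum +-0-commutativeMonoid
  using (sum; sum-syntax; sum-cong-≗; sum-init-last; ∑-comm)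

∑-mono-≤ : ∀ {n} {f g : Fin n → ℕ} → (∀ i → f i ≤ g i) → sum f ≤ sum g
∑-mono-≤ {zero}  f≤g = z≤n
∑-mono-≤ {suc n} f≤g = +-mono-≤ (f≤g zero) (∑-mono-≤ (f≤g ∘ suc))

∑-const : ∀ n c → ∑[ i < n ] c ≡ n * c
∑-const zero    c = refl
∑-const (suc n) c = cong (c +_) (∑-const n c)

∑-zero : ∀ {n} {f : Fin n → ℕ} → (∀ i → f i ≡ 0) → sum f ≡ 0
∑-zero {zero}  f≡0 = refl
∑-zero {suc n} f≡0 = cong₂ _+_ (f≡0 zero) (∑-zero (f≡0 ∘ suc))

∑-δ : ∀ {k} (x : Fin k) → ∑[ c < k ] b2n (does (x ≟ c)) ≡ 1
∑-δ {suc k} zero = cong suc (∑-zero {k} λ _ → refl)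
∑-δ (suc x)      = ∑-δ x

count : ∀ {d k} → (Fin d → Fin k) → Fin k → ℕ
count {d} f c = ∑[ x < d ] b2n (does (f x ≟ c))

∑-count : ∀ {d k} (f : Fin d → Fin k) → ∑[ c < k ] count f c ≡ d
∑-count {d} {k} f = begin
  ∑[ c < k ] ∑[ x < d ] b2n (does (f x ≟ c))  ≡⟨ ∑-comm (λ c x → b2n (does (f x ≟ c))) ⟩
  ∑[ x < d ] ∑[ c < k ] b2n (does (f x ≟ c))  ≡⟨ sum-cong-≗ (∑-δ ∘ f) ⟩
  ∑[ x < d ] 1                                ≡⟨ ∑-const d 1 ⟩
  d * 1                                       ≡⟨ *-identityʳ d ⟩
  d                                           ∎
  where open ≡-Reasoning

count-≢ : ∀ {d k} (f : Fin d → Fin k) {c} → (∀ x → f x ≢ c) → count f c ≡ 0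
count-≢ f {c} f≢c = ∑-zero λ x → δ-≢ (f≢c x)
  where
  δ-≢ : ∀ {a} → a ≢ c → b2n (does (a ≟ c)) ≡ 0
  δ-≢ {a} a≢c with a ≟ c
  ... | yes a≡c = contradiction a≡c a≢c
  ... | no _    = refl

count-injective : ∀ {d k} {f : Fin d → Fin k} → Injective _≡_ _≡_ f → ∀ c → count f c ≤ 1
count-injective {zero}          f-inj c = z≤n
count-injective {suc d} {f = f} f-inj c with f zero ≟ c
... | yes f0≡c = ≤-reflexive (cong suc (count-≢ (f ∘ suc) λ x fx≡c →
  Fin.0≢1+n (f-inj (trans f0≡c (sym fx≡c)))))
... | no _     = count-injective (Fin.suc-injective ∘ f-inj) c

count-disjoint : ∀ {d d′ k} {f : Fin d → Fin k} {g : Fin d′ → Fin k} →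
  Injective _≡_ _≡_ f → Injective _≡_ _≡_ g → (∀ x y → f x ≢ g y) →
  ∀ c → count f c + count g c ≤ 1
count-disjoint {f = f} {g} f-inj g-inj f≢g c with any? (λ x → f x ≟ c)
... | yes (x , fx≡c) = begin
  count f c + count g c  ≡⟨ cong (count f c +_) (count-≢ g λ y gy≡c → f≢g x y (trans fx≡c (sym gy≡c))) ⟩
  count f c + 0          ≡⟨ +-identityʳ _ ⟩
  count f c              ≤⟨ count-injective f-inj c ⟩
  1                      ∎
  where open ≤-Reasoning
... | no ∄x = begin
  count f c + count g c  ≡⟨ cong (_+ count g c) (count-≢ f λ x fx≡c → ∄x (x , fx≡c)) ⟩
  count g c              ≤⟨ count-injective g-inj c ⟩
  1                      ∎
  where open ≤-Reasoning

Independent : ∀ {n} → (Fin n → Fin n → Set) → (Fin n → ℕ) → Set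
Independent R h = (∀ i → h i ≤ 1) × (∀ {i j} → R i j → h i + h j ≤ 1)

Consecutive : ∀ {n} → Fin n → Fin n → Set
Consecutive i j = suc (toℕ i) ≡ toℕ j

independent-path : ∀ {n} {h : Fin n → ℕ} → Independent Consecutive h → 2 * sum h ≤ suc n
independent-path {zero}        _                 = z≤n
independent-path {suc zero}    (h≤1 , _)         = *-monoʳ-≤ 2 (≤-trans (≤-reflexive (+-identityʳ _)) (h≤1 zero))
independent-path {suc (suc n)} {h} (h≤1 , h-adj) = begin
  2 * (h zero + (h (suc zero) + rest))   ≡⟨ cong (2 *_) (+-assoc (h zero) _ rest) ⟨
  2 * (h zero + h (suc zero) + rest)     ≡⟨ *-distribˡ-+ 2 (h zero + h (suc zero)) rest ⟩
  2 * (h zero + h (suc zero)) + 2 * rest ≤⟨ +-mono-≤ (*-monoʳ-≤ 2 (h-adj refl)) (independent-path rest-independent) ⟩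
  2 + suc n                              ∎
  where
  open ≤-Reasoning
  rest = ∑[ i < n ] h (suc (suc i))
  rest-independent : Independent Consecutive (λ i → h (suc (suc i)))
  rest-independent = (λ i → h≤1 (suc (suc i))) , h-adj ∘ cong (2 +_)

2*m≤1+2*n⇒m≤n : ∀ {m n} → 2 * m ≤ suc (2 * n) → m ≤ n
2*m≤1+2*n⇒m≤n {m} {n} 2m≤1+2n = ≮⇒≥ λ n<m → m+1+n≰m (suc (2 * n)) (begin
  suc (2 * n) + 1 ≡⟨ +-comm (suc (2 * n)) 1 ⟩
  2 + 2 * n       ≡⟨ *-suc 2 n ⟨
  2 * suc n       ≤⟨ *-monoʳ-≤ 2 n<m ⟩
  2 * m           ≤⟨ 2m≤1+2n ⟩
  suc (2 * n)     ∎)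
  where open ≤-Reasoning

independent-oddCycle : ∀ {ℓ} {h : Fin (suc (2 * ℓ)) → ℕ} →
  Independent (CycleAdj (suc (2 * ℓ))) h → sum h ≤ ℓ
independent-oddCycle {ℓ} {h} (h≤1 , h-adj) with h zero ℕ.≟ 0
... | yes h₀≡0 = 2*m≤1+2*n⇒m≤n (begin
  2 * sum h               ≡⟨ cong (λ x → 2 * (x + sum (h ∘ suc))) h₀≡0 ⟩
  2 * sum (h ∘ suc)       ≤⟨ independent-path ((λ i → h≤1 (suc i)) , h-adj ∘ inj₁ ∘ cong (1 +_)) ⟩
  suc (2 * ℓ)             ∎)
  where open ≤-Reasoning
... | no h₀≢0 = 2*m≤1+2*n⇒m≤n (begin
  2 * sum h                        ≡⟨ cong (2 *_) (sum-init-last h) ⟩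
  2 * (sum (h ∘ inject₁) + h last) ≡⟨ cong (λ x → 2 * (sum (h ∘ inject₁) + x)) hlast≡0 ⟩
  2 * (sum (h ∘ inject₁) + 0)      ≡⟨ cong (2 *_) (+-identityʳ (sum (h ∘ inject₁))) ⟩
  2 * sum (h ∘ inject₁)            ≤⟨ independent-path ((λ i → h≤1 (inject₁ i)) , h-adj ∘ inj₁ ∘ consecutive-inject₁) ⟩
  suc (2 * ℓ)                      ∎)
  where
  open ≤-Reasoning
  last = fromℕ (2 * ℓ)
  hlast≡0 : h last ≡ 0
  hlast≡0 = n≤0⇒n≡0 (+-cancelʳ-≤ 1 (h last) 0 (≤-trans (+-monoʳ-≤ (h last) (n≢0⇒n>0 h₀≢0))
    (h-adj (inj₂ (inj₂ (inj₁ (cong suc (toℕ-fromℕ (2 * ℓ)) , refl)))))))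
  consecutive-inject₁ : ∀ {i j : Fin (2 * ℓ)} → Consecutive i j → Consecutive (inject₁ i) (inject₁ j)
  consecutive-inject₁ {i} {j} c = trans (cong suc (toℕ-inject₁ i)) (trans c (sym (toℕ-inject₁ j)))

disjoint-injections-oddCycle : ∀ {ℓ d k} (f : Fin (suc (2 * ℓ)) → Fin d → Fin k) →
  (∀ i → Injective _≡_ _≡_ (f i)) →
  (∀ {i j} → CycleAdj (suc (2 * ℓ)) i j → ∀ x y → f i x ≢ f j y) →
  suc (2 * ℓ) * d ≤ k * ℓ
disjoint-injections-oddCycle {ℓ} {d} {k} f f-inj f-disj = begin
  m * d                                  ≡⟨ ∑-const m d ⟨
  ∑[ i < m ] d                           ≡⟨ sum-cong-≗ (∑-count ∘ f) ⟨
  ∑[ i < m ] ∑[ c < k ] count (f i) c    ≡⟨ ∑-comm (λ i c → count (f i) c) ⟩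
  ∑[ c < k ] ∑[ i < m ] count (f i) c    ≤⟨ ∑-mono-≤ (independent-oddCycle ∘ colour-class-independent) ⟩
  ∑[ c < k ] ℓ                           ≡⟨ ∑-const k ℓ ⟩
  k * ℓ                                  ∎
  where
  open ≤-Reasoning
  m = suc (2 * ℓ)
  colour-class-independent : ∀ c → Independent (CycleAdj m) (λ i → count (f i) c)
  colour-class-independent c =
    (λ i → count-injective (f-inj i) c) , λ i~j → count-disjoint (f-inj _) (f-inj _) (f-disj i~j) c

CycleStep : ℕ → ℕ → ℕ → Set
CycleStep n a b = suc a ≡ b ⊎ (suc a ≡ suc n × b ≡ 0)

CycleStep-irrefl : ∀ {n a} → 1 ≤ n → ¬ CycleStep n a a
CycleStep-irrefl _       (inj₁ 1+a≡a) = 1+n≢n 1+a≡a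
CycleStep-irrefl (s≤s _) (inj₂ (refl , ()))

CycleStep-antisym : ∀ {n a b} → 2 ≤ n → CycleStep n a b → CycleStep n b a → ⊥
CycleStep-antisym _             (inj₁ refl)         (inj₁ 2+a≡a) = ≤⇒≯ (≤-reflexive 2+a≡a) (n≤1+n _)
CycleStep-antisym (s≤s (s≤s _)) (inj₁ refl)         (inj₂ (refl , ()))
CycleStep-antisym (s≤s (s≤s _)) (inj₂ (refl , refl)) (inj₁ ())
CycleStep-antisym (s≤s (s≤s _)) (inj₂ (refl , refl)) (inj₂ (() , _))

CycleAdj⇒CycleStep : ∀ {n} {i j : Fin (suc n)} → CycleAdj (suc n) i j →
  CycleStep n (toℕ i) (toℕ j) ⊎ CycleStep n (toℕ j) (toℕ i)
CycleAdj⇒CycleStep (inj₁ e)               = inj₁ (inj₁ e)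
CycleAdj⇒CycleStep (inj₂ (inj₁ e))        = inj₂ (inj₁ e)
CycleAdj⇒CycleStep (inj₂ (inj₂ (inj₁ p))) = inj₁ (inj₂ p)
CycleAdj⇒CycleStep (inj₂ (inj₂ (inj₂ p))) = inj₂ (inj₂ p)

CycleAdj-irrefl : ∀ {n} {i : Fin (suc n)} → 1 ≤ n → ¬ CycleAdj (suc n) i i
CycleAdj-irrefl 1≤n = [ CycleStep-irrefl 1≤n , CycleStep-irrefl 1≤n ] ∘ CycleAdj⇒CycleStep

next : ∀ {n} → Fin (suc n) → Fin (suc n)
next {n} i with n ℕ.≟ toℕ i
... | yes _   = zero
... | no n≢i  = suc (lower₁ i n≢i)

next-step : ∀ {n} (i : Fin (suc n)) → CycleStep n (toℕ i) (toℕ (next i))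
next-step {n} i with n ℕ.≟ toℕ i
... | yes n≡i = inj₂ (cong suc (sym n≡i) , refl)
... | no n≢i  = inj₁ (cong suc (sym (toℕ-lower₁ i n≢i)))

next-adj : ∀ {n} (i : Fin (suc n)) → CycleAdj (suc n) i (next i)
next-adj i with next-step i
... | inj₁ e = inj₁ e
... | inj₂ p = inj₂ (inj₂ (inj₁ p))

next-next≢ : ∀ {n} → 2 ≤ n → (i : Fin (suc n)) → next (next i) ≢ i
next-next≢ 2≤n i nni≡i =
  CycleStep-antisym 2≤n (next-step i) (subst (CycleStep _ _) (cong toℕ nni≡i) (next-step (next i)))

sum-tabulate : ∀ {n} (f : Fin n → ℕ) → List.sum (tabulate f) ≡ sum f
sum-tabulate {zero}  f = refl
sum-tabulate {suc n} f = cong (f zero +_) (sum-tabulate (f ∘ suc))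

degree≡∑ : ∀ G v → degree G v ≡ ∑[ u < n G ] b2n (adj G v u)
degree≡∑ G v =
  trans (cong List.sum (map-tabulate id (b2n ∘ adj G v))) (sum-tabulate (b2n ∘ adj G v))

Δ-attained : ∀ G → 1 ≤ n G → ∃ λ v → Δ G ≤ degree G v
Δ-attained G 1≤n with foldr-selective ⊔-sel 0 (map (degree G) (allFin (n G)))
... | inj₁ Δ≡0 = fromℕ< 1≤n , ≤-trans (≤-reflexive Δ≡0) z≤n
... | inj₂ Δ∈  with ∈-map⁻ (degree G) Δ∈
...   | v , _ , Δ≡deg = v , ≤-reflexive Δ≡deg

prependIf : ∀ {m n} (b : Bool) → (Fin m → Fin n) → Fin (b2n b + m) → Fin (suc n)
prependIf true  s zero    = zero
prependIf true  s (suc j) = suc (s j)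
prependIf false s j       = suc (s j)

prependIf-injective : ∀ {m n} (b : Bool) {s : Fin m → Fin n} →
  Injective _≡_ _≡_ s → Injective _≡_ _≡_ (prependIf b s)
prependIf-injective true  s-inj {zero}  {zero}  _  = refl
prependIf-injective true  s-inj {suc i} {suc j} eq = cong suc (s-inj (Fin.suc-injective eq))
prependIf-injective false s-inj eq                 = s-inj (Fin.suc-injective eq)

select : ∀ {n} (p : Fin n → Bool) → Fin (∑[ i < n ] b2n (p i)) → Fin n
select {suc n} p = prependIf (p zero) (select (p ∘ suc))

select-sound : ∀ {n} (p : Fin n → Bool) j → T (p (select p j))
select-sound {suc n} p j with p zero in p₀≡
select-sound {suc n} p zero    | true  = subst T (sym p₀≡) tt
select-sound {suc n} p (suc j) | true  = select-sound (p ∘ suc) j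
select-sound {suc n} p j       | false = select-sound (p ∘ suc) j

select-injective : ∀ {n} (p : Fin n → Bool) → Injective _≡_ _≡_ (select p)
select-injective {suc n} p = prependIf-injective (p zero) (select-injective (p ∘ suc))

neighbour-enumeration : ∀ G v → ∃ λ (e : Fin (degree G v) → Fin (n G)) →
  Injective _≡_ _≡_ e × (∀ j → T (adj G v (e j)))
neighbour-enumeration G v rewrite degree≡∑ G v =
  select (adj G v) , select-injective (adj G v) , select-sound (adj G v)

module Star (G : FinGraph) {m} (2≤m : 2 ≤ m) (v : Fin (n G)) {k}
  (c : EdgeColouring (toGraph G □ cycleGraph (suc m)) k)
  (c-strong : IsStrong (toGraph G □ cycleGraph (suc m)) c) where

  P : Graph
  P = toGraph G □ cycleGraph (suc m)

  CycleAdj⇒≢ : ∀ {i j} → CycleAdj (suc m) i j → i ≢ j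
  CycleAdj⇒≢ i~j refl = CycleAdj-irrefl (≤-trans (s≤s z≤n) 2≤m) i~j

  P-irrefl : ∀ {z} → ¬ Adj P z z
  P-irrefl (inj₁ (_ , i~i))         = CycleAdj⇒≢ i~i refl
  P-irrefl {x , _} (inj₂ (_ , x~x)) = subst T (adj-irrefl G x) x~x

  neighbour : Fin (degree G v) → Fin (n G)
  neighbour = proj₁ (neighbour-enumeration G v)

  neighbour-injective : Injective _≡_ _≡_ neighbour
  neighbour-injective = proj₁ (proj₂ (neighbour-enumeration G v))

  neighbour-adj : ∀ j → T (adj G v (neighbour j))
  neighbour-adj = proj₂ (proj₂ (neighbour-enumeration G v))

  star : Fin (suc m) → Fin (suc (degree G v)) → V P
  star i zero    = v , next i
  star i (suc j) = neighbour j , i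

  star-adj : ∀ i x → Adj P (v , i) (star i x)
  star-adj i zero    = inj₁ (refl , next-adj i)
  star-adj i (suc j) = inj₂ (refl , neighbour-adj j)

  star-injective : ∀ i → Injective _≡_ _≡_ (star i)
  star-injective i {zero}  {zero}  _  = refl
  star-injective i {zero}  {suc _} eq = ⊥-elim (CycleAdj⇒≢ (next-adj i) (sym (,-injectiveʳ eq)))
  star-injective i {suc _} {zero}  eq = ⊥-elim (CycleAdj⇒≢ (next-adj i) (,-injectiveʳ eq))
  star-injective i {suc _} {suc _} eq = cong suc (neighbour-injective (,-injectiveˡ eq))

  star-layer : ∀ {i j} x → star i x ≡ (v , j) → j ≡ next i ⊎ j ≡ i
  star-layer zero    eq = inj₁ (sym (,-injectiveʳ eq))
  star-layer (suc _) eq = inj₂ (sym (,-injectiveʳ eq))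

  starColour : Fin (suc m) → Fin (suc (degree G v)) → Fin k
  starColour i x = col c (v , i) (star i x) (star-adj i x)

  starColour-injective : ∀ i → Injective _≡_ _≡_ (starColour i)
  starColour-injective i {x} {y} eq
    with c-strong (v , i) (star i x) (v , i) (star i y) (star-adj i x) (star-adj i y) eq (inj₁ refl)
  ... | inj₁ (_ , same) = star-injective i same
  ... | inj₂ (loop , _) = ⊥-elim (P-irrefl (subst (Adj P (v , i)) (sym loop) (star-adj i y)))

  -- A colour shared at adjacent centres is a single edge, necessarily the cycle edge ij designated by
  -- both stars: next i ≡ j and next j ≡ i.
  starColour-disjoint : ∀ {i j} → CycleAdj (suc m) i j → ∀ x y → starColour i x ≢ starColour j y
  starColour-disjoint {i} {j} i~j x y eq
    with c-strong (v , i) (star i x) (v , j) (star j y) (star-adj i x) (star-adj j y) eq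
                  (inj₂ (inj₁ (refl , i~j)))
  ... | inj₁ (vi≡vj , _) = CycleAdj⇒≢ i~j (,-injectiveʳ vi≡vj)
  ... | inj₂ (vi≡yʲ , xⁱ≡vj) with star-layer x xⁱ≡vj | star-layer y (sym vi≡yʲ)
  ...   | inj₂ j≡i      | _             = CycleAdj⇒≢ i~j (sym j≡i)
  ...   | _             | inj₂ i≡j      = CycleAdj⇒≢ i~j i≡j
  ...   | inj₁ j≡next-i | inj₁ i≡next-j =
          next-next≢ 2≤m i (trans (cong next (sym j≡next-i)) (sym i≡next-j))

strong-colouring-bound : ∀ G {ℓ} → 1 ≤ ℓ → ∀ v {k}
  (c : EdgeColouring (toGraph G □ cycleGraph (suc (2 * ℓ))) k) →
  IsStrong (toGraph G □ cycleGraph (suc (2 * ℓ))) c →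
  suc (2 * ℓ) * suc (degree G v) ≤ k * ℓ
strong-colouring-bound G 1≤ℓ v c c-strong =
  disjoint-injections-oddCycle starColour starColour-injective starColour-disjoint
  where open Star G (*-monoʳ-≤ 2 1≤ℓ) v c c-strong

⌈/⌉≤ : ∀ {a b k} → a ≤ k * b → ⌈ a / b ⌉ ≤ k
⌈/⌉≤ {b = zero}                _     = z≤n
⌈/⌉≤ {a} {b = suc b} {k} a≤k*b = s≤s⁻¹ (m<n*o⇒m/o<n (begin-strict
  a + b             ≤⟨ +-monoˡ-≤ b a≤k*b ⟩
  k * suc b + b     <⟨ +-monoʳ-< (k * suc b) (n<1+n b) ⟩
  k * suc b + suc b ≡⟨ +-comm (k * suc b) (suc b) ⟩
  suc k * suc b     ∎))
  where open ≤-Reasoning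

corollary15 : (T : FinGraph) → IsTree T → (ℓ : ℕ) → 1 ≤ ℓ →
    χs'≥ (toGraph T □ cycleGraph (2 * ℓ + 1))
      ⌈ (2 * ℓ + 1) * (Δ T + 1) / ℓ ⌉
corollary15 G (1≤n , _) ℓ 1≤ℓ k c c-strong with Δ-attained G 1≤n
... | v , Δ≤deg rewrite +-comm (2 * ℓ) 1 = ⌈/⌉≤ (begin
  suc (2 * ℓ) * (Δ G + 1)         ≤⟨ *-monoʳ-≤ (suc (2 * ℓ)) (+-monoˡ-≤ 1 Δ≤deg) ⟩
  suc (2 * ℓ) * (degree G v + 1)  ≡⟨ cong (suc (2 * ℓ) *_) (+-comm (degree G v) 1) ⟩
  suc (2 * ℓ) * suc (degree G v)  ≤⟨ strong-colouring-bound G 1≤ℓ v c c-strong ⟩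
  k * ℓ                           ∎)
  where open ≤-Reasoning
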